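{- Let $A,X\in\mathcal{S}_m(\mathbb{R})$ and $S_i,T\in\mathcal{S}_n(\mathbb{R})$ for $i=0,1,\ldots,n-1$ be matrices such that: (i) $A\circ X=I_m\circ X=0$ and $AX-XA=0$; (ii) $S_iT-TS_i=0$ for $i=0,\ldots,n-1$, and $S_i\circ T=0$ for $i=2,\ldots,n-1$. Then the matrices $\hat A=\sum_{j=0}^{n-1}(S_j\otimes A^j)$ and $\hat X=T\otimes X$ satisfy $\hat A\circ\hat X=I_{mn}\circ\hat X=0$ and $\hat A\hat X-\hat X\hat A=0$.
   Context: $\mathcal{S}_k(\mathbb{R})$ is the set of real symmetric $k\times k$ matrices, $\circ$ is the entrywise (Hadamard) product, $\otimes$ is the Kronecker product, $I_k$ is the $k\times k$ identity matrix, and $A^0=I_m$. -}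

module Defs where

open import Level using (_⊔_)
open import Algebra.Bundles using (CommutativeRing)
open import Data.Nat using (ℕ; zero; suc; _*_)
open import Data.Fin using (Fin; zero; suc; remQuot; _≟_)
open import Data.Product using (_,_)
open import Relation.Nullary using (yes; no)

module MatrixDefs {c ℓ} (R : CommutativeRing c ℓ) where
  open CommutativeRing R using (_≈_; _+_; _-_; 0#; 1#) renaming (Carrier to K; _*_ to _·_)

  Mat : ℕ → Set c
  Mat k = Fin k → Fin k → K

  Σ : ∀ {k} → (Fin k → K) → K
  Σ {zero}  f = 0#
  Σ {suc k} f = f zero + Σ (λ i → f (suc i))

  _≋_ : ∀ {k} → Mat k → Mat k → Set ℓ
  M ≋ N = ∀ i j → M i j ≈ N i j

  0M : ∀ {k} → Mat k
  0M i j = 0#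

  I : ∀ k → Mat k
  I k i j with i ≟ j
  ... | yes _ = 1#
  ... | no  _ = 0#

  _⊕_ : ∀ {k} → Mat k → Mat k → Mat k
  (M ⊕ N) i j = M i j + N i j

  _⊖_ : ∀ {k} → Mat k → Mat k → Mat k
  (M ⊖ N) i j = M i j - N i j

  _⊙_ : ∀ {k} → Mat k → Mat k → Mat k
  (M ⊙ N) i j = Σ (λ l → M i l · N l j)

  _∘ₕ_ : ∀ {k} → Mat k → Mat k → Mat k
  (M ∘ₕ N) i j = M i j · N i j

  _^_ : ∀ {k} → Mat k → ℕ → Mat k
  _^_ {k} M zero    = I k
  M ^ suc e = M ⊙ (M ^ e)

  ΣM : ∀ {k r} → (Fin r → Mat k) → Mat k
  ΣM {k} {zero}  F = 0M
  ΣM {k} {suc r} F = F zero ⊕ ΣM (λ i → F (suc i))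

  Symmetric : ∀ {k} → Mat k → Set ℓ
  Symmetric M = ∀ i j → M i j ≈ M j i

  -- Kronecker product: row/column index p ↔ (i , k) with p = i * m + k
  _⊗_ : ∀ {n m} → Mat n → Mat m → Mat (n * m)
  _⊗_ {n} {m} S A p q with remQuot {n} m p | remQuot {n} m q
  ... | i , k | j , l = S i j · A k l

-- Everything reduces to three
-- entrywise facts about the Kronecker product:
--   (a) (S ⊗ A) ∘ₕ (T ⊗ X) = (S ∘ₕ T) ⊗ (A ∘ₕ X), so the j-th summand of
--       Â ∘ₕ X̂ vanishes: for j = 0 since I ∘ₕ X = 0, for j = 1 since
--       A ∘ₕ X = 0, and for j ≥ 2 since Sⱼ ∘ₕ T = 0;
--   (b) a diagonal entry of S ⊗ X is a product with a diagonal entry of X,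
--       so I ∘ₕ X = 0 forces I ∘ₕ (S ⊗ X) = 0;
--   (c) the mixed-product rule (S ⊗ A)(T ⊗ X) = (ST) ⊗ (AX), so Kronecker
--       products of commuting pairs commute; since X commutes with every
--       power of A and sums of matrices commuting with X̂ commute with X̂,
--       Â commutes with X̂.
module Submission where

open import Defs
open import Algebra.Bundles using (CommutativeRing)
open import Data.Nat as ℕ using (ℕ; _≤_; _*_; z≤n; s≤s)
open import Data.Fin using (Fin; toℕ; zero; suc; remQuot; combine; _↑ˡ_; _↑ʳ_; _≟_)
open import Data.Fin.Properties using (remQuot-combine; suc-injective)
open import Data.Product using (_×_; _,_; proj₁; proj₂)
open import Relation.Nullary using (yes; no; Dec)
open import Relation.Binary.PropositionalEquality as ≡ using (_≡_; _≢_)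
open import Data.Empty using (⊥-elim)
import Algebra.Properties.CommutativeSemigroup as CommSemigroupProperties

module MatrixAlgebra {c ℓ} (R : CommutativeRing c ℓ) where
  open CommutativeRing R renaming (Carrier to K; _*_ to _·_) hiding (zero)
  open MatrixDefs R
  open import Relation.Binary.Reasoning.Setoid setoid
  open CommSemigroupProperties *-commutativeSemigroup using (interchange)

  ≡⇒≈ : ∀ {x y} → x ≡ y → x ≈ y
  ≡⇒≈ ≡.refl = refl

  difference-zero : ∀ {x y} → x - y ≈ 0# → x ≈ y
  difference-zero {x} {y} h = begin
    x             ≈⟨ sym (+-identityʳ x) ⟩
    x + 0#        ≈⟨ +-congˡ (sym (-‿inverseˡ y)) ⟩
    x + (- y + y) ≈⟨ sym (+-assoc _ _ _) ⟩
    (x - y) + y   ≈⟨ +-congʳ h ⟩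
    0# + y        ≈⟨ +-identityˡ y ⟩
    y             ∎

  Σ-cong : ∀ {k} {f g : Fin k → K} → (∀ i → f i ≈ g i) → Σ f ≈ Σ g
  Σ-cong {ℕ.zero}  h = refl
  Σ-cong {ℕ.suc k} h = +-cong (h zero) (Σ-cong (λ i → h (suc i)))

  Σ-zero : ∀ {k} {f : Fin k → K} → (∀ i → f i ≈ 0#) → Σ f ≈ 0#
  Σ-zero {ℕ.zero}  h = refl
  Σ-zero {ℕ.suc k} h = trans (+-cong (h zero) (Σ-zero (λ i → h (suc i)))) (+-identityˡ 0#)

  Σ-+ : ∀ {k} (f g : Fin k → K) → Σ (λ i → f i + g i) ≈ Σ f + Σ g
  Σ-+ {ℕ.zero}  f g = sym (+-identityˡ 0#)
  Σ-+ {ℕ.suc k} f g = trans (+-congˡ (Σ-+ (λ i → f (suc i)) (λ i → g (suc i))))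
                            (CommSemigroupProperties.interchange +-commutativeSemigroup _ _ _ _)

  Σ-*ˡ : ∀ {k} a (f : Fin k → K) → a · Σ f ≈ Σ (λ i → a · f i)
  Σ-*ˡ {ℕ.zero}  a f = zeroʳ a
  Σ-*ˡ {ℕ.suc k} a f = trans (distribˡ a _ _) (+-congˡ (Σ-*ˡ a (λ i → f (suc i))))

  Σ-*ʳ : ∀ {k} a (f : Fin k → K) → Σ f · a ≈ Σ (λ i → f i · a)
  Σ-*ʳ {ℕ.zero}  a f = zeroˡ a
  Σ-*ʳ {ℕ.suc k} a f = trans (distribʳ a _ _) (+-congˡ (Σ-*ʳ a (λ i → f (suc i))))

  Σ-swap : ∀ {a b} (f : Fin a → Fin b → K) →
           Σ (λ i → Σ (λ j → f i j)) ≈ Σ (λ j → Σ (λ i → f i j))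
  Σ-swap {ℕ.zero}  {b} f = sym (Σ-zero {b} (λ j → refl))
  Σ-swap {ℕ.suc a} {b} f = trans (+-congˡ (Σ-swap (λ i → f (suc i))))
                                 (sym (Σ-+ (f zero) (λ j → Σ (λ i → f (suc i) j))))

  Σ-split : ∀ m k (f : Fin (m ℕ.+ k) → K) →
            Σ f ≈ Σ (λ i → f (i ↑ˡ k)) + Σ (λ j → f (m ↑ʳ j))
  Σ-split ℕ.zero    k f = sym (+-identityˡ _)
  Σ-split (ℕ.suc m) k f = trans (+-congˡ (Σ-split m k (λ i → f (suc i)))) (sym (+-assoc _ _ _))

  Σ-combine : ∀ n m (f : Fin (n * m) → K) →
              Σ f ≈ Σ {n} (λ i → Σ {m} (λ k → f (combine i k)))
  Σ-combine ℕ.zero    m f = refl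
  Σ-combine (ℕ.suc n) m f =
    trans (Σ-split m (n * m) f) (+-congˡ (Σ-combine n m (λ p → f (m ↑ʳ p))))

  I-diagonal : ∀ k (i j : Fin k) → i ≡ j → I k i j ≈ 1#
  I-diagonal k i j i≡j with i ≟ j
  ... | yes _   = refl
  ... | no  i≢j = ⊥-elim (i≢j i≡j)

  I-off-diagonal : ∀ k (i j : Fin k) → i ≢ j → I k i j ≈ 0#
  I-off-diagonal k i j i≢j with i ≟ j
  ... | yes i≡j = ⊥-elim (i≢j i≡j)
  ... | no  _   = refl

  I-suc : ∀ k (i j : Fin k) → I (ℕ.suc k) (suc i) (suc j) ≈ I k i j
  I-suc k i j = by-cases (i ≟ j)
    where
    by-cases : Dec (i ≡ j) → I (ℕ.suc k) (suc i) (suc j) ≈ I k i j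
    by-cases (yes i≡j) = trans (I-diagonal _ (suc i) (suc j) (≡.cong suc i≡j)) (sym (I-diagonal k i j i≡j))
    by-cases (no i≢j)  = trans (I-off-diagonal _ (suc i) (suc j) (λ e → i≢j (suc-injective e)))
                               (sym (I-off-diagonal k i j i≢j))

  I-symmetric : ∀ k (i j : Fin k) → I k i j ≈ I k j i
  I-symmetric k i j = by-cases (i ≟ j)
    where
    by-cases : Dec (i ≡ j) → I k i j ≈ I k j i
    by-cases (yes i≡j) = trans (I-diagonal k i j i≡j) (sym (I-diagonal k j i (≡.sym i≡j)))
    by-cases (no i≢j)  = trans (I-off-diagonal k i j i≢j) (sym (I-off-diagonal k j i (λ e → i≢j (≡.sym e))))

  Σ-δʳ : ∀ k (f : Fin k → K) j → Σ (λ l → f l · I k l j) ≈ f j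
  Σ-δʳ (ℕ.suc k) f zero = begin
    f zero · I (ℕ.suc k) zero zero + Σ (λ l → f (suc l) · I (ℕ.suc k) (suc l) zero)
      ≈⟨ +-cong (*-congˡ (I-diagonal (ℕ.suc k) zero zero ≡.refl))
                (Σ-zero {k} (λ l → trans (*-congˡ (I-off-diagonal (ℕ.suc k) (suc l) zero (λ ()))) (zeroʳ _))) ⟩
    f zero · 1# + 0#  ≈⟨ +-identityʳ _ ⟩
    f zero · 1#       ≈⟨ *-identityʳ _ ⟩
    f zero            ∎
  Σ-δʳ (ℕ.suc k) f (suc j) = begin
    f zero · I _ zero (suc j) + Σ (λ l → f (suc l) · I _ (suc l) (suc j))
      ≈⟨ +-cong (trans (*-congˡ (I-off-diagonal _ zero (suc j) (λ ()))) (zeroʳ _))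
                (Σ-cong {k} (λ l → *-congˡ (I-suc k l j))) ⟩
    0# + Σ (λ l → f (suc l) · I k l j)  ≈⟨ +-identityˡ _ ⟩
    Σ (λ l → f (suc l) · I k l j)       ≈⟨ Σ-δʳ k (λ l → f (suc l)) j ⟩
    f (suc j)                           ∎

  Σ-δˡ : ∀ k (f : Fin k → K) i → Σ (λ l → I k i l · f l) ≈ f i
  Σ-δˡ k f i = trans (Σ-cong (λ l → trans (*-comm _ _) (*-congˡ (I-symmetric k i l)))) (Σ-δʳ k f i)

  diagonal-zero : ∀ {k} {X : Mat k} → (I k ∘ₕ X) ≋ 0M → ∀ b → X b b ≈ 0#
  diagonal-zero {k} {X} h b = begin
    X b b           ≈⟨ sym (*-identityˡ _) ⟩
    1# · X b b      ≈⟨ *-congʳ (sym (I-diagonal k b b ≡.refl)) ⟩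
    I k b b · X b b ≈⟨ h b b ⟩
    0#              ∎

  ≋-refl : ∀ {k} {M : Mat k} → M ≋ M
  ≋-refl i j = refl

  ≋-sym : ∀ {k} {M N : Mat k} → M ≋ N → N ≋ M
  ≋-sym h i j = sym (h i j)

  ≋-trans : ∀ {k} {M N L : Mat k} → M ≋ N → N ≋ L → M ≋ L
  ≋-trans h g i j = trans (h i j) (g i j)

  ⊖-zero⇒≋ : ∀ {k} {M N : Mat k} → (M ⊖ N) ≋ 0M → M ≋ N
  ⊖-zero⇒≋ h i j = difference-zero (h i j)

  ≋⇒⊖-zero : ∀ {k} {M N : Mat k} → M ≋ N → (M ⊖ N) ≋ 0M
  ≋⇒⊖-zero h i j = trans (+-congˡ (-‿cong (sym (h i j)))) (-‿inverseʳ _)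

  ∘ₕ-congˡ : ∀ {k} {M M′ N : Mat k} → M ≋ M′ → (M ∘ₕ N) ≋ (M′ ∘ₕ N)
  ∘ₕ-congˡ h i j = *-congʳ (h i j)

  ⊙-cong : ∀ {k} {M M′ N N′ : Mat k} → M ≋ M′ → N ≋ N′ → (M ⊙ N) ≋ (M′ ⊙ N′)
  ⊙-cong h g i j = Σ-cong (λ l → *-cong (h i l) (g l j))

  ⊙-assoc : ∀ {k} (M N L : Mat k) → ((M ⊙ N) ⊙ L) ≋ (M ⊙ (N ⊙ L))
  ⊙-assoc {k} M N L i j = begin
    Σ (λ l → Σ (λ t → M i t · N t l) · L l j)
      ≈⟨ Σ-cong (λ l → Σ-*ʳ (L l j) (λ t → M i t · N t l)) ⟩
    Σ (λ l → Σ (λ t → (M i t · N t l) · L l j))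
      ≈⟨ Σ-swap (λ l t → (M i t · N t l) · L l j) ⟩
    Σ (λ t → Σ (λ l → (M i t · N t l) · L l j))
      ≈⟨ Σ-cong {k} (λ t → Σ-cong {k} (λ l → *-assoc _ _ _)) ⟩
    Σ (λ t → Σ (λ l → M i t · (N t l · L l j)))
      ≈⟨ Σ-cong (λ t → sym (Σ-*ˡ (M i t) (λ l → N t l · L l j))) ⟩
    Σ (λ t → M i t · Σ (λ l → N t l · L l j)) ∎

  I-⊙ : ∀ {k} (M : Mat k) → (I k ⊙ M) ≋ M
  I-⊙ {k} M i j = Σ-δˡ k (λ l → M l j) i

  ⊙-I : ∀ {k} (M : Mat k) → (M ⊙ I k) ≋ M
  ⊙-I {k} M i j = Σ-δʳ k (λ l → M i l) j

  ^-comm : ∀ {k} {A X : Mat k} → (A ⊙ X) ≋ (X ⊙ A) → ∀ r → ((A ^ r) ⊙ X) ≋ (X ⊙ (A ^ r))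
  ^-comm {X = X} h ℕ.zero = ≋-trans (I-⊙ X) (≋-sym (⊙-I X))
  ^-comm {A = A} {X} h (ℕ.suc r) =
    ≋-trans (⊙-assoc A (A ^ r) X)
    (≋-trans (⊙-cong ≋-refl (^-comm h r))
    (≋-trans (≋-sym (⊙-assoc A X (A ^ r)))
    (≋-trans (⊙-cong h ≋-refl)
             (⊙-assoc X A (A ^ r)))))

  ΣM-entry : ∀ {k r} (F : Fin r → Mat k) i j → ΣM F i j ≡ Σ (λ t → F t i j)
  ΣM-entry {r = ℕ.zero}  F i j = ≡.refl
  ΣM-entry {r = ℕ.suc r} F i j = ≡.cong (F zero i j +_) (ΣM-entry (λ t → F (suc t)) i j)

  ΣM-zero : ∀ {k r} {F : Fin r → Mat k} → (∀ t → F t ≋ 0M) → ΣM F ≋ 0M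
  ΣM-zero {F = F} h i j = trans (≡⇒≈ (ΣM-entry F i j)) (Σ-zero (λ t → h t i j))

  ΣM-cong : ∀ {k r} {F G : Fin r → Mat k} → (∀ t → F t ≋ G t) → ΣM F ≋ ΣM G
  ΣM-cong {F = F} {G} h i j = begin
    ΣM F i j             ≡⟨ ΣM-entry F i j ⟩
    Σ (λ t → F t i j)    ≈⟨ Σ-cong (λ t → h t i j) ⟩
    Σ (λ t → G t i j)    ≡⟨ ≡.sym (ΣM-entry G i j) ⟩
    ΣM G i j             ∎

  ΣM-∘ₕ : ∀ {k r} (F : Fin r → Mat k) N → (ΣM F ∘ₕ N) ≋ ΣM (λ t → F t ∘ₕ N)
  ΣM-∘ₕ F N i j = begin
    ΣM F i j · N i j                  ≡⟨ ≡.cong (_· N i j) (ΣM-entry F i j) ⟩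
    Σ (λ t → F t i j) · N i j         ≈⟨ Σ-*ʳ (N i j) (λ t → F t i j) ⟩
    Σ (λ t → F t i j · N i j)         ≡⟨ ≡.sym (ΣM-entry (λ t → F t ∘ₕ N) i j) ⟩
    ΣM (λ t → F t ∘ₕ N) i j           ∎

  ΣM-⊙ : ∀ {k r} (F : Fin r → Mat k) N → (ΣM F ⊙ N) ≋ ΣM (λ t → F t ⊙ N)
  ΣM-⊙ {r = r} F N i j = begin
    Σ (λ l → ΣM F i l · N l j)             ≈⟨ Σ-cong (λ l → *-congʳ (≡⇒≈ (ΣM-entry F i l))) ⟩
    Σ (λ l → Σ {r} (λ t → F t i l) · N l j) ≈⟨ Σ-cong (λ l → Σ-*ʳ (N l j) (λ t → F t i l)) ⟩
    Σ (λ l → Σ {r} (λ t → F t i l · N l j)) ≈⟨ Σ-swap (λ l t → F t i l · N l j) ⟩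
    Σ {r} (λ t → Σ (λ l → F t i l · N l j)) ≡⟨ ≡.sym (ΣM-entry (λ t → F t ⊙ N) i j) ⟩
    ΣM (λ t → F t ⊙ N) i j                 ∎

  ⊙-ΣM : ∀ {k r} N (F : Fin r → Mat k) → (N ⊙ ΣM F) ≋ ΣM (λ t → N ⊙ F t)
  ⊙-ΣM {r = r} N F i j = begin
    Σ (λ l → N i l · ΣM F l j)             ≈⟨ Σ-cong (λ l → *-congˡ (≡⇒≈ (ΣM-entry F l j))) ⟩
    Σ (λ l → N i l · Σ {r} (λ t → F t l j)) ≈⟨ Σ-cong (λ l → Σ-*ˡ (N i l) (λ t → F t l j)) ⟩
    Σ (λ l → Σ {r} (λ t → N i l · F t l j)) ≈⟨ Σ-swap (λ l t → N i l · F t l j) ⟩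
    Σ {r} (λ t → Σ (λ l → N i l · F t l j)) ≡⟨ ≡.sym (ΣM-entry (λ t → N ⊙ F t) i j) ⟩
    ΣM (λ t → N ⊙ F t) i j                 ∎

  ΣM-comm : ∀ {k r} (F : Fin r → Mat k) N →
            (∀ t → (F t ⊙ N) ≋ (N ⊙ F t)) → (ΣM F ⊙ N) ≋ (N ⊙ ΣM F)
  ΣM-comm F N h = ≋-trans (ΣM-⊙ F N) (≋-trans (ΣM-cong h) (≋-sym (⊙-ΣM N F)))

  module Kronecker {n m : ℕ} where

    row : Fin (n * m) → Fin n
    row p = proj₁ (remQuot {n} m p)

    col : Fin (n * m) → Fin m
    col p = proj₂ (remQuot {n} m p)

    ⊗-entry : (S : Mat n) (A : Mat m) → ∀ p q →
              (S ⊗ A) p q ≡ S (row p) (row q) · A (col p) (col q)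
    ⊗-entry S A p q with remQuot {n} m p | remQuot {n} m q
    ... | i , k | j , l = ≡.refl

    row-combine : ∀ i k → row (combine i k) ≡ i
    row-combine i k = ≡.cong proj₁ (remQuot-combine {n} {m} i k)

    col-combine : ∀ i k → col (combine i k) ≡ k
    col-combine i k = ≡.cong proj₂ (remQuot-combine {n} {m} i k)

    ⊗-cong : ∀ {S S′ : Mat n} {A A′ : Mat m} → S ≋ S′ → A ≋ A′ → (S ⊗ A) ≋ (S′ ⊗ A′)
    ⊗-cong {S} {S′} {A} {A′} h g p q = begin
      (S ⊗ A) p q                              ≡⟨ ⊗-entry S A p q ⟩
      S (row p) (row q) · A (col p) (col q)    ≈⟨ *-cong (h _ _) (g _ _) ⟩
      S′ (row p) (row q) · A′ (col p) (col q)  ≡⟨ ≡.sym (⊗-entry S′ A′ p q) ⟩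
      (S′ ⊗ A′) p q                            ∎

    ⊗-zeroˡ : ∀ {S : Mat n} (A : Mat m) → S ≋ 0M → (S ⊗ A) ≋ 0M
    ⊗-zeroˡ {S} A h p q = trans (≡⇒≈ (⊗-entry S A p q)) (trans (*-congʳ (h _ _)) (zeroˡ _))

    ⊗-zeroʳ : ∀ (S : Mat n) {A : Mat m} → A ≋ 0M → (S ⊗ A) ≋ 0M
    ⊗-zeroʳ S {A} h p q = trans (≡⇒≈ (⊗-entry S A p q)) (trans (*-congˡ (h _ _)) (zeroʳ _))

    ⊗-∘ₕ : (S T : Mat n) (A X : Mat m) → ((S ⊗ A) ∘ₕ (T ⊗ X)) ≋ ((S ∘ₕ T) ⊗ (A ∘ₕ X))
    ⊗-∘ₕ S T A X p q = begin
      (S ⊗ A) p q · (T ⊗ X) p q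
        ≡⟨ ≡.cong₂ _·_ (⊗-entry S A p q) (⊗-entry T X p q) ⟩
      (S (row p) (row q) · A (col p) (col q)) · (T (row p) (row q) · X (col p) (col q))
        ≈⟨ interchange _ _ _ _ ⟩
      (S ∘ₕ T) (row p) (row q) · (A ∘ₕ X) (col p) (col q)
        ≡⟨ ≡.sym (⊗-entry (S ∘ₕ T) (A ∘ₕ X) p q) ⟩
      ((S ∘ₕ T) ⊗ (A ∘ₕ X)) p q ∎

    ⊗-diagonal-zero : (S : Mat n) {X : Mat m} → (I m ∘ₕ X) ≋ 0M → (I (n * m) ∘ₕ (S ⊗ X)) ≋ 0M
    ⊗-diagonal-zero S {X} h p q = by-cases (p ≟ q)
      where
      by-cases : Dec (p ≡ q) → I (n * m) p q · (S ⊗ X) p q ≈ 0#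
      by-cases (no p≢q)    = trans (*-congʳ (I-off-diagonal (n * m) p q p≢q)) (zeroˡ _)
      by-cases (yes ≡.refl) = begin
        I (n * m) p p · (S ⊗ X) p p              ≈⟨ *-congˡ (≡⇒≈ (⊗-entry S X p p)) ⟩
        I (n * m) p p · (S (row p) (row p) · X (col p) (col p))
          ≈⟨ *-congˡ (*-congˡ (diagonal-zero h (col p))) ⟩
        I (n * m) p p · (S (row p) (row p) · 0#) ≈⟨ *-congˡ (zeroʳ _) ⟩
        I (n * m) p p · 0#                       ≈⟨ zeroʳ _ ⟩
        0#                                       ∎

    ⊗-⊙ : (S T : Mat n) (A X : Mat m) → ((S ⊗ A) ⊙ (T ⊗ X)) ≋ ((S ⊙ T) ⊗ (A ⊙ X))
    ⊗-⊙ S T A X p q = begin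
      Σ (λ s → (S ⊗ A) p s · (T ⊗ X) s q)
        ≈⟨ Σ-combine n m (λ s → (S ⊗ A) p s · (T ⊗ X) s q) ⟩
      Σ {n} (λ i → Σ {m} (λ k → (S ⊗ A) p (combine i k) · (T ⊗ X) (combine i k) q))
        ≈⟨ Σ-cong {n} (λ i → Σ-cong {m} (λ k → ≡⇒≈ (summand i k))) ⟩
      Σ {n} (λ i → Σ {m} (λ k → (S (row p) i · A (col p) k) · (T i (row q) · X k (col q))))
        ≈⟨ Σ-cong {n} (λ i → Σ-cong {m} (λ k → interchange _ _ _ _)) ⟩
      Σ {n} (λ i → Σ {m} (λ k → (S (row p) i · T i (row q)) · (A (col p) k · X k (col q))))
        ≈⟨ Σ-cong {n} (λ i → sym (Σ-*ˡ (S (row p) i · T i (row q)) (λ k → A (col p) k · X k (col q)))) ⟩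
      Σ {n} (λ i → (S (row p) i · T i (row q)) · (A ⊙ X) (col p) (col q))
        ≈⟨ sym (Σ-*ʳ ((A ⊙ X) (col p) (col q)) (λ i → S (row p) i · T i (row q))) ⟩
      (S ⊙ T) (row p) (row q) · (A ⊙ X) (col p) (col q)
        ≡⟨ ≡.sym (⊗-entry (S ⊙ T) (A ⊙ X) p q) ⟩
      ((S ⊙ T) ⊗ (A ⊙ X)) p q ∎
      where
      summand : ∀ i k → (S ⊗ A) p (combine i k) · (T ⊗ X) (combine i k) q
                      ≡ (S (row p) i · A (col p) k) · (T i (row q) · X k (col q))
      summand i k rewrite ⊗-entry S A p (combine i k) | ⊗-entry T X (combine i k) q
                        | row-combine i k | col-combine i k = ≡.refl

    ⊗-comm : {S T : Mat n} {A X : Mat m} → (S ⊙ T) ≋ (T ⊙ S) → (A ⊙ X) ≋ (X ⊙ A) →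
             ((S ⊗ A) ⊙ (T ⊗ X)) ≋ ((T ⊗ X) ⊙ (S ⊗ A))
    ⊗-comm {S} {T} {A} {X} ST≋TS AX≋XA =
      ≋-trans (⊗-⊙ S T A X) (≋-trans (⊗-cong ST≋TS AX≋XA) (≋-sym (⊗-⊙ T S X A)))

lemma2p2 : ∀ {c ℓ} (R : CommutativeRing c ℓ) → let open MatrixDefs R in
  (m n : ℕ) (A X : Mat m) (S : Fin n → Mat n) (T : Mat n) →
  Symmetric A → Symmetric X → (∀ i → Symmetric (S i)) → Symmetric T →
  (A ∘ₕ X) ≋ 0M → (I m ∘ₕ X) ≋ 0M → ((A ⊙ X) ⊖ (X ⊙ A)) ≋ 0M →
  (∀ i → ((S i ⊙ T) ⊖ (T ⊙ S i)) ≋ 0M) →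
  (∀ i → 2 ≤ toℕ i → (S i ∘ₕ T) ≋ 0M) →
  let Â = ΣM (λ j → S j ⊗ (A ^ toℕ j))
      X̂ = T ⊗ X
  in (Â ∘ₕ X̂) ≋ 0M × (I (n * m) ∘ₕ X̂) ≋ 0M × ((Â ⊙ X̂) ⊖ (X̂ ⊙ Â)) ≋ 0M
lemma2p2 R m n A X S T _ _ _ _ A∘X≋0 I∘X≋0 [A,X]≋0 [S,T]≋0 S∘T≋0 =
  ≋-trans (ΣM-∘ₕ summand X̂) (ΣM-zero summand-orthogonal) ,
  ⊗-diagonal-zero T I∘X≋0 ,
  ≋⇒⊖-zero (ΣM-comm summand X̂ λ j →
    ⊗-comm (⊖-zero⇒≋ ([S,T]≋0 j)) (^-comm (⊖-zero⇒≋ [A,X]≋0) (toℕ j)))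
  where
  open MatrixDefs R
  open MatrixAlgebra R
  open Kronecker {n} {m}

  summand : Fin n → Mat (n * m)
  summand j = S j ⊗ (A ^ toℕ j)

  X̂ : Mat (n * m)
  X̂ = T ⊗ X

  -- j = 0: A⁰ = I;  j = 1: A¹ = A;  j ≥ 2: Sⱼ ∘ₕ T = 0.
  summand-orthogonal : ∀ j → (summand j ∘ₕ X̂) ≋ 0M
  summand-orthogonal j@zero = ≋-trans (⊗-∘ₕ (S j) T (I m) X)
    (⊗-zeroʳ (S j ∘ₕ T) I∘X≋0)
  summand-orthogonal j@(suc zero) = ≋-trans (⊗-∘ₕ (S j) T (A ^ 1) X)
    (⊗-zeroʳ (S j ∘ₕ T) (≋-trans (∘ₕ-congˡ (⊙-I A)) A∘X≋0))
  summand-orthogonal j@(suc (suc _)) = ≋-trans (⊗-∘ₕ (S j) T (A ^ toℕ j) X)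
    (⊗-zeroˡ ((A ^ toℕ j) ∘ₕ X) (S∘T≋0 j (s≤s (s≤s z≤n))))
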